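{- Let $\mathfrak{G}$ be a finite group and let $\chi$ be a class function on $\mathfrak{G}$ with values in the quasisymmetric functions of degree $d$. If $\chi$ is $F$-effective, then $\chi$ is $M$-increasing.
   Context: Integer compositions of $d$ are ordered by refinement: $\alpha\le\beta$ iff $\beta$ refines $\alpha$. $M_\alpha$ are the monomial quasisymmetric functions and $F_\alpha=\sum_{\beta\ge\alpha}M_\beta$ the fundamental ones. For a basis element $b$, $[b]\chi$ is the complex class function $\mathfrak{g}\mapsto$ coefficient of $b$ in $\chi(\mathfrak{g})$. An effective character is a nonnegative integer combination of irreducible characters. $\chi$ is $F$-effective if every $[F_\alpha]\chi$ is an effective character; $\chi$ is $M$-increasing if $[M_\beta]\chi-[M_\alpha]\chi$ is an effective character whenever $\alpha\le\beta$. -}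

module Defs where

open import Level using (Level; _⊔_; suc)
open import Data.Nat as ℕ using (ℕ; zero; _∸_; _≤_) renaming (suc to 1+)
open import Data.Fin using (Fin; _≟_)
open import Data.Fin.Subset using (Subset; _⊆_; inside; outside)
open import Data.Fin.Subset.Properties using (_⊆?_)
open import Data.Vec using (_∷_; [])
open import Data.List using (List; []; _∷_; _++_; [_]; map; foldr)
open import Data.Product using (Σ; _×_; ∃; ∃-syntax)
open import Relation.Nullary using (¬_; does)
open import Data.Bool using (if_then_else_)
open import Algebra.Bundles using (CommutativeRing; Group)

-- A composition (α₁,…,α_k) of d is encoded (standard bijection) by its
-- set of partial sums {α₁, α₁+α₂, …, α₁+…+α_{k-1}} ⊆ {1,…,d-1};
-- element i : Fin (d ∸ 1) stands for the partial sum i+1.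
-- (For d = 0 there is exactly one composition, the empty one, and
-- exactly one subset of Fin 0.)
-- β refines α  iff  the partial-sum set of α is contained in that of β.

Composition : ℕ → Set
Composition d = Subset (d ∸ 1)

_≼_ : {d : ℕ} → Composition d → Composition d → Set
α ≼ β = α ⊆ β

IsFiniteGroup : {g ℓg : Level} → Group g ℓg → Set (g ⊔ ℓg)
IsFiniteGroup G = Σ ℕ λ n → Σ (Fin n → Carrier) λ e → ∀ x → ∃[ i ] (e i ≈ x)
  where open Group G

-- Scalars: a field of characteristic 0 which is algebraically closed
-- (the role of ℂ, which is not constructible in agda-stdlib).

module _ {c ℓ : Level} (K : CommutativeRing c ℓ) where
  open CommutativeRing K

  natK : ℕ → Carrier
  natK zero = 0#
  natK (1+ n) = 1# + natK n

  -- polynomial with coefficient list a₀ ∷ a₁ ∷ … (lowest degree first)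
  evalPoly : List Carrier → Carrier → Carrier
  evalPoly [] x = 0#
  evalPoly (a ∷ as) x = a + x * evalPoly as x

  record IsAlgClosedChar0Field : Set (c ⊔ ℓ) where
    field
      nontrivial   : ¬ (1# ≈ 0#)
      inverse      : ∀ x → ¬ (x ≈ 0#) → ∃[ y ] (x * y ≈ 1#)
      char0        : ∀ n → ¬ (natK (1+ n) ≈ 0#)
      algClosed    : ∀ a as → ∃[ x ] (evalPoly ((a ∷ as) ++ [ 1# ]) x ≈ 0#)

  sumFin : {n : ℕ} → (Fin n → Carrier) → Carrier
  sumFin {zero} f = 0#
  sumFin {1+ n} f = f Data.Fin.zero + sumFin (λ i → f (Data.Fin.suc i))

  sumSub : {n : ℕ} → (Subset n → Carrier) → Carrier
  sumSub {zero} f = f []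
  sumSub {1+ n} f = sumSub (λ p → f (outside ∷ p)) + sumSub (λ p → f (inside ∷ p))

  sumList : List Carrier → Carrier
  sumList = foldr _+_ 0#

  Vect : ℕ → Set c
  Vect n = Fin n → Carrier

  Mat : ℕ → Set c
  Mat n = Fin n → Fin n → Carrier

  _≋_ : {n : ℕ} → Vect n → Vect n → Set ℓ
  u ≋ v = ∀ i → u i ≈ v i

  zeroV : {n : ℕ} → Vect n
  zeroV _ = 0#

  idMat : {n : ℕ} → Mat n
  idMat i j = if does (i ≟ j) then 1# else 0#

  _⊗_ : {n : ℕ} → Mat n → Mat n → Mat n
  (A ⊗ B) i j = sumFin (λ k → A i k * B k j)

  _·v_ : {n : ℕ} → Mat n → Vect n → Vect n
  (A ·v v) i = sumFin (λ k → A i k * v k)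

  trace : {n : ℕ} → Mat n → Carrier
  trace A = sumFin (λ i → A i i)

  record IsSubspace {n : ℕ} (W : Vect n → Set (c ⊔ ℓ)) : Set (c ⊔ ℓ) where
    field
      resp  : ∀ {u v} → u ≋ v → W u → W v
      has0  : W zeroV
      addC  : ∀ {u v} → W u → W v → W (λ i → u i + v i)
      scalC : ∀ a {u} → W u → W (λ i → a * u i)

  module _ {g ℓg : Level} (G : Group g ℓg) where
    private module G = Group G

    IsClassFunction : (G.Carrier → Carrier) → Set (g ⊔ ℓg ⊔ ℓ)
    IsClassFunction f =
      (∀ {x y} → x G.≈ y → f x ≈ f y) ×
      (∀ x h → f ((h G.∙ x) G.∙ (h G.⁻¹)) ≈ f x)

    record Rep (n : ℕ) : Set (g ⊔ ℓg ⊔ c ⊔ ℓ) where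
      field
        ρ     : G.Carrier → Mat n
        ρ-cong : ∀ {x y} → x G.≈ y → ∀ i j → ρ x i j ≈ ρ y i j
        ρ-hom  : ∀ x y i j → ρ (x G.∙ y) i j ≈ (ρ x ⊗ ρ y) i j
        ρ-ε    : ∀ i j → ρ G.ε i j ≈ idMat i j

    IsIrreducible : {n : ℕ} → Rep n → Set (suc (c ⊔ ℓ) ⊔ g)
    IsIrreducible {n} r =
      (1 ≤ n) ×
      (∀ (W : Vect n → Set (c ⊔ ℓ)) → IsSubspace W →
         (∀ x v → W v → W (Rep.ρ r x ·v v)) →
         (∃[ v ] (W v × ¬ (v ≋ zeroV))) →
         ∀ v → W v)

    character : {n : ℕ} → Rep n → G.Carrier → Carrier
    character r x = trace (Rep.ρ r x)

    IrrRep : Set (suc (c ⊔ ℓ) ⊔ g ⊔ ℓg)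
    IrrRep = Σ ℕ λ n → Σ (Rep n) IsIrreducible

    irrChar : IrrRep → G.Carrier → Carrier
    irrChar (n Data.Product., r Data.Product., _) = character r

    -- effective character: a nonnegative integer combination of
    -- irreducible characters (= a finite sum, with repetitions)
    IsEffective : (G.Carrier → Carrier) → Set (suc (c ⊔ ℓ) ⊔ g ⊔ ℓg)
    IsEffective ψ = Σ (List IrrRep) λ L → ∀ x → ψ x ≈ sumList (map (λ ρ → irrChar ρ x) L)

    -- QSym_d-valued class functions.  An element of QSym_d is given by
    -- its coordinates in the monomial basis (M_β)_β, so
    -- χ x β = [M_β] (χ x).

    QSym : ℕ → Set c
    QSym d = Composition d → Carrier

    -- fundamental quasisymmetric function F_α = Σ_{β ≥ α} M_β
    Fund : {d : ℕ} → Composition d → QSym d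
    Fund α β = if does (α ⊆? β) then 1# else 0#

    IsQSymClassFunction : (d : ℕ) → (G.Carrier → QSym d) → Set (g ⊔ ℓg ⊔ ℓ)
    IsQSymClassFunction d χ = ∀ (β : Composition d) → IsClassFunction (λ x → χ x β)

    IsFEffective : (d : ℕ) → (G.Carrier → QSym d) → Set (suc (c ⊔ ℓ) ⊔ g ⊔ ℓg)
    IsFEffective d χ =
      Σ (Composition d → G.Carrier → Carrier) λ coef →
        (∀ α → IsEffective (coef α)) ×
        (∀ x β → χ x β ≈ sumSub (λ α → coef α x * Fund {d} α β))

    IsMIncreasing : (d : ℕ) → (G.Carrier → QSym d) → Set (suc (c ⊔ ℓ) ⊔ g ⊔ ℓg)
    IsMIncreasing d χ =
      ∀ (α β : Composition d) → _≼_ {d} α β → IsEffective (λ x → χ x β - χ x α)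

{-# OPTIONS --safe #-}
module Submission where

-- Expanding the fundamental basis, [M_β]χ = Σ_{γ ≤ β} [F_γ]χ.  For α ≤ β every
-- γ ≤ α is also ≤ β, so [M_β]χ − [M_α]χ = Σ_{γ ≤ β, γ ≰ α} [F_γ]χ, a sum of
-- effective characters; and effective characters are closed under finite sums.

open import Defs
open import Level using (Level)
open import Data.Nat using (ℕ; zero; suc)
open import Algebra.Bundles using (CommutativeRing; Group)
open import Data.List using ([]; _∷_; _++_; map)
open import Data.List.Properties using (map-++)
open import Data.Vec using (_∷_; [])
open import Data.Fin.Subset using (Subset; inside; outside)
open import Data.Fin.Subset.Properties using (_⊆?_; ⊆-trans)
open import Data.Product using (_,_)
open import Relation.Nullary using (yes; no)
open import Data.Empty using (⊥-elim)
import Algebra.Properties.AbelianGroup as AbelianGroupProperties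
import Algebra.Properties.CommutativeSemigroup as CommutativeSemigroupProperties
import Algebra.Properties.Group as GroupProperties
import Relation.Binary.Reasoning.Setoid as SetoidReasoning
open import Relation.Binary.PropositionalEquality using (cong)

module _ {c ℓ : Level} (K : CommutativeRing c ℓ) where
  open CommutativeRing K
  open SetoidReasoning setoid
  open AbelianGroupProperties +-abelianGroup using (⁻¹-∙-comm)
  open CommutativeSemigroupProperties +-commutativeSemigroup using (interchange)
  open GroupProperties +-group using (ε⁻¹≈ε)

  sumList-++ : ∀ xs ys → sumList K (xs ++ ys) ≈ sumList K xs + sumList K ys
  sumList-++ []       ys = sym (+-identityˡ _)
  sumList-++ (x ∷ xs) ys = trans (+-congˡ (sumList-++ xs ys)) (sym (+-assoc _ _ _))

  -‿+-interchange : ∀ a b u v → (a + b) - (u + v) ≈ (a - u) + (b - v)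
  -‿+-interchange a b u v = trans (+-congˡ (sym (⁻¹-∙-comm u v))) (interchange a b (- u) (- v))

  sumSub-- : ∀ {n} (f h : Subset n → Carrier) → sumSub K f - sumSub K h ≈ sumSub K (λ p → f p - h p)
  sumSub-- {zero}  f h = refl
  sumSub-- {suc n} f h = trans (-‿+-interchange _ _ _ _)
    (+-cong (sumSub-- {n} (λ p → f (outside ∷ p)) (λ p → h (outside ∷ p)))
            (sumSub-- {n} (λ p → f (inside ∷ p)) (λ p → h (inside ∷ p))))

  *1-*0≈id : ∀ a → a * 1# - a * 0# ≈ a
  *1-*0≈id a = begin
    a * 1# - a * 0# ≈⟨ +-cong (*-identityʳ a) (-‿cong (zeroʳ a)) ⟩
    a - 0#          ≈⟨ +-congˡ ε⁻¹≈ε ⟩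
    a + 0#          ≈⟨ +-identityʳ a ⟩
    a               ∎

  module _ {g ℓg : Level} (G : Group g ℓg) where
    private module G = Group G

    effective-cong : {φ ψ : G.Carrier → Carrier} → (∀ x → φ x ≈ ψ x) →
                     IsEffective K G φ → IsEffective K G ψ
    effective-cong φ≈ψ (L , φ≈ΣL) = L , λ x → trans (sym (φ≈ψ x)) (φ≈ΣL x)

    effective-0 : IsEffective K G (λ _ → 0#)
    effective-0 = [] , λ _ → refl

    effective-+ : {φ ψ : G.Carrier → Carrier} → IsEffective K G φ → IsEffective K G ψ →
                  IsEffective K G (λ x → φ x + ψ x)
    effective-+ (L , φ≈ΣL) (L′ , ψ≈ΣL′) = L ++ L′ , λ x → begin
      _ ≈⟨ +-cong (φ≈ΣL x) (ψ≈ΣL′ x) ⟩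
      _ ≈⟨ sym (sumList-++ (map (λ ρ → irrChar K G ρ x) L) _) ⟩
      _ ≡⟨ cong (sumList K) (map-++ (λ ρ → irrChar K G ρ x) L L′) ⟨
      _ ∎

    effective-sumSub : ∀ {n} {φ : Subset n → G.Carrier → Carrier} → (∀ p → IsEffective K G (φ p)) →
                       IsEffective K G (λ x → sumSub K (λ p → φ p x))
    effective-sumSub {zero}  eff = eff []
    effective-sumSub {suc n} eff =
      effective-+ (effective-sumSub {n} (λ p → eff _)) (effective-sumSub {n} (λ p → eff _))

    effective-*Fund-difference : ∀ {d} {φ : G.Carrier → Carrier} (γ : Composition d) {α β : Composition d} →
      _≼_ {d} α β → IsEffective K G φ →
      IsEffective K G (λ x → φ x * Fund K G {d} γ β - φ x * Fund K G {d} γ α)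
    effective-*Fund-difference γ {α} {β} α≼β eff with γ ⊆? β | γ ⊆? α
    ... | yes _   | yes _   = effective-cong (λ _ → sym (-‿inverseʳ _)) effective-0
    ... | yes _   | no _    = effective-cong (λ _ → sym (*1-*0≈id _)) eff
    ... | no γ⋠β  | yes γ≼α = ⊥-elim (γ⋠β (⊆-trans γ≼α α≼β))
    ... | no _    | no _    = effective-cong (λ _ → sym (-‿inverseʳ _)) effective-0

    F-effective⇒M-increasing : (d : ℕ) (χ : G.Carrier → QSym K G d) →
                               IsFEffective K G d χ → IsMIncreasing K G d χ
    F-effective⇒M-increasing d χ (coef , coef-eff , χ≈ΣcoefF) α β α≼β =
      effective-cong (λ x → sym (χβ-χα≈Σ x))
        (effective-sumSub (λ γ → effective-*Fund-difference {d} γ α≼β (coef-eff γ)))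
      where
      term : Composition d → Composition d → G.Carrier → Carrier
      term δ γ x = coef γ x * Fund K G {d} γ δ

      χβ-χα≈Σ : ∀ x → χ x β - χ x α ≈ sumSub K (λ γ → term β γ x - term α γ x)
      χβ-χα≈Σ x = begin
        χ x β - χ x α
          ≈⟨ +-cong (χ≈ΣcoefF x β) (-‿cong (χ≈ΣcoefF x α)) ⟩
        sumSub K (λ γ → term β γ x) - sumSub K (λ γ → term α γ x)
          ≈⟨ sumSub-- (λ γ → term β γ x) (λ γ → term α γ x) ⟩
        sumSub K (λ γ → term β γ x - term α γ x)
          ∎

proposition2p1 : {c ℓ g ℓg : Level} (K : CommutativeRing c ℓ) → IsAlgClosedChar0Field K →
    (G : Group g ℓg) → IsFiniteGroup G →
    (d : ℕ) (χ : Group.Carrier G → QSym K G d) →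
    IsQSymClassFunction K G d χ →
    IsFEffective K G d χ →
    IsMIncreasing K G d χ
proposition2p1 K _ G _ d χ _ = F-effective⇒M-increasing K G d χ
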